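{- Let $s$ be a composition. If $C$ is a clique of routes of the framed graph $(G_s,\preceq)$ that contains $R(n+1,1,(0)^n)$, $R(n+1,1,(1)^n)$, and, for each source-edge $e$ other than the edge $(v_{ -1},v_0)$, at least one route whose first edge is $e$, then the simplex $\Delta_C$ is an interior simplex of the DKK triangulation of $\mathcal F_{G_s}$, i.e. it is not contained in the boundary of $\mathcal F_{G_s}$.
   Context: $s=(s_1,\dots,s_n)$ is a composition. Graph $G_s$ ($s_{n+1}:=2$): vertices $v_{ -1},\dots,v_n$; source-edges $e^i_1,\dots,e^i_{s_i-1}$ from $v_{ -1}$ to $v_{n+1-i}$ ($i\in[1,n+1]$; the only edge $(v_{ -1},v_0)$ is $e^{n+1}_1$); bump $e^i_0$ and dip $e^i_{s_i}$ from $v_{n-i}$ to $v_{n+1-i}$ ($i\in[1,n]$). Routes are $R(k,t,\delta)=(e^k_t,e^{k-1}_{\delta_{k-1}s_{k-1}},\dots,e^1_{\delta_1s_1})$, $k\in[1,n+1]$, $t\in[1,s_k-1]$, $\delta\in\{0,1\}^{k-1}$. $\mathcal F_{G_s}\subset\mathbb R^E$: nonnegative flows with netflow $1$ at $v_{ -1}$, $-1$ at $v_n$, $0$ elsewhere; vertices are route indicator vectors $\chi_R$. Framing $\preceq$: incoming edges at $v_{n+1-i}$ ordered $e^i_0\prec\dots\prec e^i_{s_i}$; outgoing at $v_{n+1-i}$ ordered $e^{i-1}_0\prec e^{i-1}_{s_{i-1}}$. Two routes are coherent if at each maximal common subpath from inner vertex $v_i$ to inner vertex $v_j$ their initial parts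 up to $v_i$ and final parts from $v_j$ are ordered the same way, partial routes being compared via the framing order of their edges at the vertex where they last (resp. first) diverge. A clique is a set of pairwise coherent routes, $\Delta_C=\mathrm{conv}\{\chi_R:R\in C\}$, and these simplices form the DKK triangulation of $\mathcal F_{G_s}$. -}

module Defs where

open import Data.Nat using (ℕ; zero; suc; _∸_; _≤_; _<_; _≟_; _≡ᵇ_; _≤ᵇ_)
open import Data.Bool using (Bool; true; false; if_then_else_; _∧_)
open import Data.List using (List; []; _∷_; length; map; filter; upTo; concatMap; foldr; _++_)
open import Data.List.Relation.Unary.All using (All)
open import Data.List.Membership.Propositional using (_∈_)
open import Data.Product using (_×_; _,_; Σ; proj₁; proj₂)
open import Data.Rational as ℚ using (ℚ; 0ℚ; 1ℚ)
open import Relation.Binary.PropositionalEquality using (_≡_; _≢_)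

IsComposition : List ℕ → Set
IsComposition s = All (1 ≤_) s

-- sAt s i = s_i for 1 ≤ i ≤ n, and sAt s (n+1) = s_{n+1} := 2
-- (junk value 0 elsewhere).
sAt : List ℕ → ℕ → ℕ
sAt _ zero = 0
sAt [] (suc zero) = 2
sAt [] (suc (suc _)) = 0
sAt (x ∷ xs) (suc zero) = x
sAt (x ∷ xs) (suc (suc i)) = sAt xs (suc i)

-- The edge e^i_j is encoded as the pair (i , j).
--   source edges e^i_j, 1 ≤ j ≤ s_i - 1, i ∈ [1,n+1] : v_{-1} → v_{n+1-i}
--   bump e^i_0 and dip e^i_{s_i}, i ∈ [1,n]         : v_{n-i} → v_{n+1-i}
-- Vertices are encoded by naturals: v_{-1} ↦ 0, v_j ↦ j+1 (j ∈ [0,n]).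

Edge : Set
Edge = ℕ × ℕ

allEdges : List ℕ → List Edge
allEdges s =
  concatMap (λ i → map (λ j → (suc i , j)) (upTo (suc (sAt s (suc i))))) (upTo (length s))
  ++ ((suc (length s) , 1) ∷ [])

isSourceEdge : List ℕ → Edge → Bool
isSourceEdge s (i , j) = (1 ≤ᵇ j) ∧ (suc j ≤ᵇ sAt s i)

tailV : List ℕ → Edge → ℕ
tailV s (i , j) = if isSourceEdge s (i , j) then 0 else (suc (length s) ∸ i)

headV : List ℕ → Edge → ℕ
headV s (i , j) = suc (suc (length s)) ∸ i

-- Routes R(k,t,δ) encoded as (k , t , δ) with δ = [δ_1 , … , δ_{k-1}].

RouteData : Set
RouteData = ℕ × ℕ × List Bool

IsRoute : List ℕ → RouteData → Set
IsRoute s (k , t , δ) =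
  1 ≤ k × k ≤ suc (length s) × 1 ≤ t × suc t ≤ sAt s k × length δ ≡ k ∸ 1

routeLength : RouteData → ℕ
routeLength (k , _ , _) = k

-- δAt δ i = δ_i (1-indexed)
δAt : List Bool → ℕ → Bool
δAt [] _ = false
δAt (b ∷ bs) zero = false
δAt (b ∷ bs) (suc zero) = b
δAt (b ∷ bs) (suc (suc i)) = δAt bs (suc i)

-- For 1 ≤ i ≤ k, the route R(k,t,δ) uses exactly one edge with head
-- v_{n+1-i}, namely e^i_{lev s R i}:  lev = t if i = k, and
-- δ_i s_i if i < k.
lev : List ℕ → RouteData → ℕ → ℕ
lev s (k , t , δ) i = if i ≡ᵇ k then t else (if δAt δ i then sAt s i else 0)

χ : List ℕ → RouteData → Edge → ℚ
χ s R (i , j) =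
  if (1 ≤ᵇ i) ∧ (i ≤ᵇ routeLength R) ∧ (lev s R i ≡ᵇ j) then 1ℚ else 0ℚ

-- Incoming edges at v_{n+1-i} (which are exactly the e^i_j):
-- e^i_0 ≺ e^i_1 ≺ … ≺ e^i_{s_i}; outgoing edges at v_{n+1-i}:
-- e^{i-1}_0 ≺ e^{i-1}_{s_{i-1}}.

framingIn : (i j j' : ℕ) → Set      -- e^i_j ≺ e^i_j' in In(v_{n+1-i})
framingIn i j j' = j < j'

framingOut : (i j j' : ℕ) → Set     -- e^i_j ≺ e^i_j' in Out(v_{n-i})
framingOut i j j' = j < j'

-- Below, vertex v_{n+1-i} is called "level i" (i ∈ [1,n+1]); the inner
-- vertices are the levels i ∈ [2,n+1]; route R(k,…) visits levels 1..k.

-- Initial part of P up to level b is ≺ initial part of Q up to level b: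
-- going backwards from level b, they last diverge at level m (first
-- level ≥ b where their incoming edges differ), compared by framingIn.
PrefixLess : List ℕ → RouteData → RouteData → ℕ → Set
PrefixLess s P Q b = Σ ℕ λ m →
  b ≤ m × m ≤ routeLength P × m ≤ routeLength Q ×
  (∀ i → b ≤ i → i < m → lev s P i ≡ lev s Q i) ×
  framingIn m (lev s P m) (lev s Q m)

-- Final part of P from level a is ≺ final part of Q from level a:
-- they first diverge at the vertex of level m+1 (first level m < a whose
-- edges differ), compared by framingOut.
SuffixLess : List ℕ → RouteData → RouteData → ℕ → Set
SuffixLess s P Q a = Σ ℕ λ m →
  1 ≤ m × m < a ×
  (∀ i → m < i → i < a → lev s P i ≡ lev s Q i) ×
  framingOut m (lev s P m) (lev s Q m)

MaxCommonSubpath : List ℕ → RouteData → RouteData → ℕ → ℕ → Set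
MaxCommonSubpath s P Q a b =
  2 ≤ a × a ≤ b × b ≤ routeLength P × b ≤ routeLength Q ×
  (∀ i → a ≤ i → i < b → lev s P i ≡ lev s Q i) ×
  lev s P b ≢ lev s Q b ×                           -- not extendable backwards
  lev s P (a ∸ 1) ≢ lev s Q (a ∸ 1)                 -- not extendable forwards

Coherent : List ℕ → RouteData → RouteData → Set
Coherent s P Q = ∀ a b → MaxCommonSubpath s P Q a b →
  (PrefixLess s P Q b → SuffixLess s P Q a) ×
  (PrefixLess s Q P b → SuffixLess s Q P a)

Clique : List ℕ → List RouteData → Set
Clique s C = All (IsRoute s) C × (∀ P Q → P ∈ C → Q ∈ C → Coherent s P Q)

sumℚ : List ℚ → ℚ
sumℚ = foldr ℚ._+_ 0ℚ

netflow : List ℕ → (Edge → ℚ) → ℕ → ℚ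
netflow s x p =
  sumℚ (map x (filter (λ e → tailV s e ≟ p) (allEdges s)))
  ℚ.- sumℚ (map x (filter (λ e → headV s e ≟ p) (allEdges s)))

InFlowPolytope : List ℕ → (Edge → ℚ) → Set
InFlowPolytope s x =
  (∀ e → e ∈ allEdges s → 0ℚ ℚ.≤ x e) ×
  netflow s x 0 ≡ 1ℚ ×
  netflow s x (suc (length s)) ≡ ℚ.- 1ℚ ×
  (∀ p → 1 ≤ p → p ≤ length s → netflow s x p ≡ 0ℚ)

-- relative boundary of F_{G_s}: the flows with some vanishing coordinate
InBoundary : List ℕ → (Edge → ℚ) → Set
InBoundary s x = InFlowPolytope s x × Σ Edge λ e → e ∈ allEdges s × x e ≡ 0ℚ

InSimplex : List ℕ → List RouteData → (Edge → ℚ) → Set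
InSimplex s C x = Σ (List (RouteData × ℚ)) λ ws →
  map proj₁ ws ≡ C ×
  All (λ w → 0ℚ ℚ.≤ proj₂ w) ws ×
  sumℚ (map proj₂ ws) ≡ 1ℚ ×
  (∀ e → e ∈ allEdges s → x e ≡ sumℚ (map (λ w → proj₂ w ℚ.* χ s (proj₁ w) e) ws))

{-# OPTIONS --safe #-}
module Submission where

-- Every edge of G_s lies on a route of C: the bumps on R(n+1,1,(0)^n), the
-- dips on R(n+1,1,(1)^n), the edge (v_{-1},v_0) on both, and every other
-- source edge by hypothesis.  So a convex combination of the χ_R (R ∈ C)
-- with strictly positive weights is a point of Δ_C with no vanishing
-- coordinate, hence not on the boundary.

open import Defs
open import Data.Nat using (ℕ; zero; suc; _≤_; z≤n; s≤s; s≤s⁻¹; _≟_; _≡ᵇ_; _≤ᵇ_)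
open import Data.Nat.Properties as ℕ using (≤⇒≤ᵇ; ≡⇒≡ᵇ; ≡ᵇ⇒≡; ≤∧≢⇒<)
open import Data.Bool using (Bool; true; false; if_then_else_; _∧_)
open import Data.List using (List; []; _∷_; length; replicate; map; upTo; concatMap)
open import Data.List.Properties using (map-∘)
open import Data.List.Membership.Propositional using (_∈_; find)
open import Data.List.Membership.Propositional.Properties
  using (∈-++⁻; ∈-concatMap⁻; ∈-map⁻; ∈-upTo⁻)
open import Data.List.Relation.Unary.All as All using (All; []; _∷_)
open import Data.List.Relation.Unary.Any using (here; there)
open import Data.Product using (_,_; ∃; _×_; proj₁; proj₂; map₂)
open import Data.Sum using (_⊎_; inj₁; inj₂)
open import Data.Empty using (⊥-elim)
open import Data.Unit using (tt)
open import Data.Rational as ℚ using (ℚ; 0ℚ; 1ℚ; ½)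
open import Data.Rational.Properties
  using (≤-refl; <⇒≤; <-irrefl; +-mono-≤; +-mono-<-≤; +-mono-≤-<; *-zeroʳ;
         *-distribˡ-+; positive⁻¹; nonNegative⁻¹; pos*pos⇒pos; nonNeg*nonNeg⇒nonNeg)
open import Relation.Nullary using (¬_; yes; no)
open import Relation.Binary.PropositionalEquality
  using (_≡_; refl; sym; trans; cong; subst; module ≡-Reasoning)

*-pos : ∀ {q r} → 0ℚ ℚ.< q → 0ℚ ℚ.< r → 0ℚ ℚ.< q ℚ.* r
*-pos {q} {r} q>0 r>0 =
  positive⁻¹ _ {{pos*pos⇒pos q {{ℚ.positive q>0}} r {{ℚ.positive r>0}}}}

*-nonNeg : ∀ {q r} → 0ℚ ℚ.≤ q → 0ℚ ℚ.≤ r → 0ℚ ℚ.≤ q ℚ.* r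
*-nonNeg {q} {r} q≥0 r≥0 =
  nonNegative⁻¹ _ {{nonNeg*nonNeg⇒nonNeg q {{ℚ.nonNegative q≥0}} r {{ℚ.nonNegative r≥0}}}}

sumℚ-*-distribˡ : ∀ c qs → sumℚ (map (c ℚ.*_) qs) ≡ c ℚ.* sumℚ qs
sumℚ-*-distribˡ c []       = sym (*-zeroʳ c)
sumℚ-*-distribˡ c (q ∷ qs) = trans (cong (c ℚ.* q ℚ.+_) (sumℚ-*-distribˡ c qs))
                                   (sym (*-distribˡ-+ c q (sumℚ qs)))

module _ {A : Set} where

  PositiveWeights : List (A × ℚ) → Set
  PositiveWeights = All (λ w → 0ℚ ℚ.< proj₂ w)

  combination : List (A × ℚ) → (A → ℚ) → ℚ
  combination ws f = sumℚ (map (λ w → proj₂ w ℚ.* f (proj₁ w)) ws)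

  combination-nonNeg : ∀ {ws f} → PositiveWeights ws → (∀ a → 0ℚ ℚ.≤ f a) →
    0ℚ ℚ.≤ combination ws f
  combination-nonNeg []           f≥0 = ≤-refl
  combination-nonNeg (w>0 ∷ w>0s) f≥0 =
    +-mono-≤ (*-nonNeg (<⇒≤ w>0) (f≥0 _)) (combination-nonNeg w>0s f≥0)

  combination-pos : ∀ {ws f a} → PositiveWeights ws → (∀ b → 0ℚ ℚ.≤ f b) →
    a ∈ map proj₁ ws → 0ℚ ℚ.< f a → 0ℚ ℚ.< combination ws f
  combination-pos (w>0 ∷ w>0s) f≥0 (here refl) fa>0 =
    +-mono-<-≤ (*-pos w>0 fa>0) (combination-nonNeg w>0s f≥0)
  combination-pos (w>0 ∷ w>0s) f≥0 (there a∈) fa>0 =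
    +-mono-≤-< (*-nonNeg (<⇒≤ w>0) (f≥0 _)) (combination-pos w>0s f≥0 a∈ fa>0)

  halvingWeights : A → List A → List (A × ℚ)
  halvingWeights a []       = (a , 1ℚ) ∷ []
  halvingWeights a (b ∷ bs) = (a , ½) ∷ map (map₂ (½ ℚ.*_)) (halvingWeights b bs)

  halvingWeights-support : ∀ a as → map proj₁ (halvingWeights a as) ≡ a ∷ as
  halvingWeights-support a []       = refl
  halvingWeights-support a (b ∷ bs) =
    cong (a ∷_) (trans (sym (map-∘ (halvingWeights b bs))) (halvingWeights-support b bs))

  halvingWeights-sum : ∀ a as → sumℚ (map proj₂ (halvingWeights a as)) ≡ 1ℚ
  halvingWeights-sum a []       = refl
  halvingWeights-sum a (b ∷ bs) = cong (½ ℚ.+_) (begin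
    sumℚ (map proj₂ (map (map₂ (½ ℚ.*_)) ws)) ≡⟨ cong sumℚ (sym (map-∘ ws)) ⟩
    sumℚ (map (λ w → ½ ℚ.* proj₂ w) ws)       ≡⟨ cong sumℚ (map-∘ ws) ⟩
    sumℚ (map (½ ℚ.*_) (map proj₂ ws))       ≡⟨ sumℚ-*-distribˡ ½ (map proj₂ ws) ⟩
    ½ ℚ.* sumℚ (map proj₂ ws)                ≡⟨ cong (½ ℚ.*_) (halvingWeights-sum b bs) ⟩
    ½ ℚ.* 1ℚ                                 ∎)
    where
    open ≡-Reasoning
    ws = halvingWeights b bs

  halvingWeights-positive : ∀ a as → PositiveWeights (halvingWeights a as)
  halvingWeights-positive a []       = positive⁻¹ 1ℚ ∷ []
  halvingWeights-positive a (b ∷ bs) = positive⁻¹ ½ ∷ halve (halvingWeights-positive b bs)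
    where
    halve : ∀ {ws} → PositiveWeights ws → PositiveWeights (map (map₂ (½ ℚ.*_)) ws)
    halve []           = []
    halve (w>0 ∷ w>0s) = *-pos (positive⁻¹ ½) w>0 ∷ halve w>0s

Uses : List ℕ → RouteData → Edge → Set
Uses s R (i , j) = 1 ≤ i × i ≤ routeLength R × lev s R i ≡ j

χ-uses : ∀ s R e → Uses s R e → χ s R e ≡ 1ℚ
χ-uses s R (i , j) (1≤i , i≤k , levᵢ≡j)
  with 1 ≤ᵇ i | ≤⇒≤ᵇ 1≤i | i ≤ᵇ routeLength R | ≤⇒≤ᵇ i≤k
     | lev s R i ≡ᵇ j | ≡⇒≡ᵇ _ _ levᵢ≡j
... | true | _ | true | _ | true | _ = refl

χ-nonNeg : ∀ s R e → 0ℚ ℚ.≤ χ s R e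
χ-nonNeg s R (i , j) with (1 ≤ᵇ i) ∧ (i ≤ᵇ routeLength R) ∧ (lev s R i ≡ᵇ j)
... | true  = nonNegative⁻¹ 1ℚ
... | false = ≤-refl

lev-last : ∀ s k t δ → lev s (k , t , δ) k ≡ t
lev-last s k t δ with k ≡ᵇ k | ≡⇒≡ᵇ k k refl
... | true | _ = refl

δAt-replicate : ∀ n b i → 1 ≤ i → i ≤ n → δAt (replicate n b) i ≡ b
δAt-replicate (suc n) b (suc zero)    _ _       = refl
δAt-replicate (suc n) b (suc (suc i)) _ (s≤s i≤n) = δAt-replicate n b (suc i) (s≤s z≤n) i≤n

lev-replicate : ∀ s n t b i → 1 ≤ i → i ≤ n →
  lev s (suc n , t , replicate n b) i ≡ (if b then sAt s i else 0)
lev-replicate s n t b i 1≤i i≤n with i ≡ᵇ suc n | ≡ᵇ⇒≡ i (suc n)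
... | true  | i≡1+n = ⊥-elim (ℕ.<⇒≢ (s≤s i≤n) (i≡1+n tt))
... | false | _     = cong (λ b′ → if b′ then sAt s i else 0) (δAt-replicate n b i 1≤i i≤n)

allEdges-cases : ∀ s e → e ∈ allEdges s →
  e ≡ (suc (length s) , 1) ⊎
  ∃ λ i → ∃ λ j → e ≡ (i , j) × 1 ≤ i × i ≤ length s × j ≤ sAt s i
allEdges-cases s e e∈ with ∈-++⁻ (concatMap levelEdges (upTo (length s))) e∈
  where levelEdges = λ i → map (λ j → (suc i , j)) (upTo (suc (sAt s (suc i))))
... | inj₂ (here refl) = inj₁ refl
... | inj₁ e∈ with find (∈-concatMap⁻ _ {xs = upTo (length s)} e∈)
... | i , i∈ , e∈ᵢ with ∈-map⁻ (λ j → (suc i , j)) e∈ᵢ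
... | j , j∈ , refl = inj₂ (suc i , j , refl , s≤s z≤n , ∈-upTo⁻ i∈ , s≤s⁻¹ (∈-upTo⁻ j∈))

constantRoute : ℕ → Bool → RouteData
constantRoute n b = (suc n , 1 , replicate n b)

constantRoute-uses-top : ∀ s n b → Uses s (constantRoute n b) (suc n , 1)
constantRoute-uses-top s n b = s≤s z≤n , ℕ.≤-refl , lev-last s (suc n) 1 (replicate n b)

constantRoute-uses : ∀ s n b i → 1 ≤ i → i ≤ n →
  Uses s (constantRoute n b) (i , (if b then sAt s i else 0))
constantRoute-uses s n b i 1≤i i≤n = 1≤i , ℕ.m≤n⇒m≤1+n i≤n , lev-replicate s n 1 b i 1≤i i≤n

allEdges-covered : ∀ s C →
  constantRoute (length s) false ∈ C → constantRoute (length s) true ∈ C →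
  (∀ i t → 1 ≤ i → i ≤ length s → 1 ≤ t → suc t ≤ sAt s i → ∃ λ δ → (i , t , δ) ∈ C) →
  ∀ e → e ∈ allEdges s → ∃ λ R → R ∈ C × Uses s R e
allEdges-covered s C bumps dips sources e e∈ with allEdges-cases s e e∈
... | inj₁ refl = _ , bumps , constantRoute-uses-top s (length s) false
... | inj₂ (i , zero , refl , 1≤i , i≤n , _) =
  _ , bumps , constantRoute-uses s (length s) false i 1≤i i≤n
... | inj₂ (i , suc t , refl , 1≤i , i≤n , t<sᵢ) with suc t ≟ sAt s i
...   | yes t≡sᵢ = _ , dips , subst (λ j → Uses s (constantRoute (length s) true) (i , j)) (sym t≡sᵢ)
                                     (constantRoute-uses s (length s) true i 1≤i i≤n)
...   | no t≢sᵢ with sources i (suc t) 1≤i i≤n (s≤s z≤n) (≤∧≢⇒< t<sᵢ t≢sᵢ)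
...     | δ , R∈C = _ , R∈C , 1≤i , ℕ.≤-refl , lev-last s i (suc t) δ

positivePoint : ∀ s R Rs → (∀ e → e ∈ allEdges s → ∃ λ R′ → R′ ∈ R ∷ Rs × Uses s R′ e) →
  ∃ λ x → InSimplex s (R ∷ Rs) x × (∀ e → e ∈ allEdges s → 0ℚ ℚ.< x e)
positivePoint s R Rs covered =
  x , (ws , support , All.map <⇒≤ positive , halvingWeights-sum R Rs , λ _ _ → refl) , x>0
  where
  ws = halvingWeights R Rs
  support = halvingWeights-support R Rs
  positive = halvingWeights-positive R Rs

  x : Edge → ℚ
  x e = combination ws (λ R → χ s R e)

  x>0 : ∀ e → e ∈ allEdges s → 0ℚ ℚ.< x e
  x>0 e e∈E =
    let R′ , R′∈C , R′-uses-e = covered e e∈E in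
    combination-pos positive (λ R → χ-nonNeg s R e) (subst (R′ ∈_) (sym support) R′∈C)
      (subst (0ℚ ℚ.<_) (sym (χ-uses s R′ e R′-uses-e)) (positive⁻¹ 1ℚ))

lemma3p16 : (s : List ℕ) → IsComposition s →
    (C : List RouteData) → Clique s C →
    (suc (length s) , 1 , replicate (length s) false) ∈ C →
    (suc (length s) , 1 , replicate (length s) true) ∈ C →
    (∀ i t → 1 ≤ i → i ≤ length s → 1 ≤ t → suc t ≤ sAt s i →
      ∃ λ δ → (i , t , δ) ∈ C) →
    ¬ (∀ x → InSimplex s C x → InBoundary s x)
lemma3p16 s _ []       _ ()    _    _       _
lemma3p16 s _ (R ∷ Rs) _ bumps dips sources Δ⊆∂ =
  let x , x∈Δ , x>0      = positivePoint s R Rs (allEdges-covered s (R ∷ Rs) bumps dips sources)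
      _ , e , e∈E , xₑ≡0 = Δ⊆∂ x x∈Δ
  in  <-irrefl (sym xₑ≡0) (x>0 e e∈E)
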